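{- Let $q$ be a prime power, let $n,k,s,h$ be positive integers with $\gcd(n,s)=1$ and $k<n$, and let $\eta\in\mathbb{F}_{q^n}^*$ satisfy $N_{q^{sn}/q^s}(\eta)\neq(-1)^{nk}$. Then the adjoint code of $\mathcal{H}_{k,s}(\eta,h)$ is equivalent to $\mathcal{H}_{k,s}(1/\eta,\,sk-h)$.
   Context: All polynomials are $q$-polynomials over $\mathbb{F}_{q^n}$, i.e. $f(x)=\sum_{i=0}^{n-1}a_ix^{q^i}$ with $a_i\in\mathbb{F}_{q^n}$, considered modulo $x^{q^n}-x$; indices of exponents $q^i$ and exponents of Frobenius powers are taken modulo $n$. $N_{q^{sn}/q^s}(\eta)=\eta^{1+q^s+\dots+q^{s(n-1)}}$. For integers $k,s,h$ and $\eta\in\mathbb{F}_{q^n}$, $\mathcal{H}_{k,s}(\eta,h)=\{a_0x+a_1x^{q^s}+\dots+a_{k-1}x^{q^{s(k-1)}}+\eta a_0^{q^h}x^{q^{sk}} : a_0,\dots,a_{k-1}\in\mathbb{F}_{q^n}\}$. The adjoint of $f=\sum_{i=0}^{n-1}a_ix^{q^i}$ is $\hat f=\sum_{i=0}^{n-1}a_{n-i}^{q^i}x^{q^i}$ (with $a_n=a_0$), and the adjoint code of $\mathcal{C}$ is $\{\hat f: f\in\mathcal{C}\}$. Two sets $\mathcal{C},\mathcal{C}'$ of $q$-polynomials are equivalent if there exist permutation $q$-polynomials $L_1,L_2$ and $\rho\in\mathrm{Aut}(\mathbb{F}_q)$ with $\mathcal{C}'=\{L_1\circ f^\rho\circ L_2: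 f\in\mathcal{C}\}$, where $(\sum a_ix^{q^i})^\rho:=\sum a_i^\rho x^{q^i}$. -}

module Defs where

open import Level using (Level; _⊔_)
open import Data.Nat as ℕ using (ℕ; zero; suc; _<_; _≤_; NonZero)
open import Data.Nat.Primality using (Prime)
open import Data.Nat.GCD using (gcd)
open import Data.Nat.DivMod using (_%_)
open import Data.Integer as ℤ using (ℤ; _%ℕ_)
open import Data.Fin as Fin using (Fin; toℕ)
open import Data.Product using (Σ; ∃; ∃-syntax; _×_; _,_)
open import Relation.Nullary using (¬_; yes; no)
open import Algebra.Bundles using (CommutativeRing)

IsPrimePower : ℕ → Set
IsPrimePower q = ∃[ p ] ∃[ e ] (Prime p × 1 ≤ e × q ≡ℕ p ℕ.^ e)
  where open import Relation.Binary.PropositionalEquality renaming (_≡_ to _≡ℕ_)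

module FiniteFieldTheory {c ℓ : Level} (F : CommutativeRing c ℓ) where
  open CommutativeRing F

  IsField : Set (c ⊔ ℓ)
  IsField = (¬ (1# ≈ 0#)) × (∀ x → ¬ (x ≈ 0#) → ∃[ y ] (x * y ≈ 1#))

  HasCardinality : ℕ → Set (c ⊔ ℓ)
  HasCardinality m =
    Σ (Fin m → Carrier) λ e →
      (∀ i j → e i ≈ e j → i ≡F j) × (∀ x → ∃[ i ] (e i ≈ x))
    where open import Relation.Binary.PropositionalEquality renaming (_≡_ to _≡F_)

  pow : Carrier → ℕ → Carrier
  pow x zero = 1#
  pow x (suc m) = x * pow x m

  sumℕ : ℕ → (ℕ → Carrier) → Carrier
  sumℕ zero f = 0#
  sumℕ (suc m) f = sumℕ m f + f m

  prodℕ : ℕ → (ℕ → Carrier) → Carrier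
  prodℕ zero f = 1#
  prodℕ (suc m) f = prodℕ m f * f m

  module QPoly (q n : ℕ) .{{_ : NonZero n}} where

    frob : ℕ → Carrier → Carrier
    frob i x = pow x (q ℕ.^ i)

    frobℤ : ℤ → Carrier → Carrier
    frobℤ i x = frob (i %ℕ n) x

    -- a q-polynomial Σ_{i<n} a_i x^{q^i} (mod x^{q^n} - x), by its coefficients
    QPol : Set c
    QPol = Fin n → Carrier

    coeff : QPol → ℕ → Carrier
    coeff f i = f (Fin.fromℕ< (Data.Nat.DivMod.m%n<n i n))
      where import Data.Nat.DivMod

    eval : QPol → Carrier → Carrier
    eval f x = sumℕ n (λ i → coeff f i * frob i x)

    _≋_ : QPol → QPol → Set ℓ
    f ≋ g = ∀ i → f i ≈ g i

    _⊕_ : QPol → QPol → QPol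
    (f ⊕ g) i = f i + g i

    zeroP : QPol
    zeroP i = 0#

    mono : ℕ → Carrier → QPol
    mono m a i with toℕ i ℕ.≟ (m % n)
    ... | yes _ = a
    ... | no _ = 0#

    -- composition f ∘ g modulo x^{q^n} - x:
    -- (f ∘ g)_m = Σ_{i<n} f_i g_{m-i}^{q^i}
    _∘P_ : QPol → QPol → QPol
    (f ∘P g) m = sumℕ n (λ i → coeff f i * frob i (coeff g ((toℕ m ℕ.+ (n ℕ.∸ i)))))

    adjoint : QPol → QPol
    adjoint f i = frob (toℕ i) (coeff f (n ℕ.∸ toℕ i))

    mapCoeff : (Carrier → Carrier) → QPol → QPol
    mapCoeff ρ f i = ρ (f i)

    IsPermutationQPol : QPol → Set (c ⊔ ℓ)
    IsPermutationQPol L =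
      (∀ x y → eval L x ≈ eval L y → x ≈ y) × (∀ y → ∃[ x ] (eval L x ≈ y))

    IsAutomorphism : (Carrier → Carrier) → Set (c ⊔ ℓ)
    IsAutomorphism ρ =
      (∀ {x y} → x ≈ y → ρ x ≈ ρ y) ×
      (∀ x y → ρ (x + y) ≈ ρ x + ρ y) ×
      (∀ x y → ρ (x * y) ≈ ρ x * ρ y) ×
      (ρ 1# ≈ 1#) ×
      (∀ x y → ρ x ≈ ρ y → x ≈ y) × (∀ y → ∃[ x ] (ρ x ≈ y))

    -- sets of q-polynomials as predicates
    Code : Set (Level.suc (c ⊔ ℓ))
    Code = QPol → Set (c ⊔ ℓ)

    adjointCode : Code → Code
    adjointCode C g = ∃[ f ] (C f × g ≋ adjoint f)

    SameCode : Code → Code → Set (c ⊔ ℓ)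
    SameCode C D = (∀ f → C f → D f) × (∀ f → D f → C f)

    Equivalent : Code → Code → Set (c ⊔ ℓ)
    Equivalent C C' =
      ∃[ L₁ ] ∃[ L₂ ] ∃[ ρ ]
        (IsPermutationQPol L₁ × IsPermutationQPol L₂ × IsAutomorphism ρ ×
         (∀ g → C' g → ∃[ f ] (C f × g ≋ (L₁ ∘P (mapCoeff ρ f ∘P L₂)))) ×
         (∀ f → C f → C' (L₁ ∘P (mapCoeff ρ f ∘P L₂))))

    norm : ℕ → Carrier → Carrier
    norm s η = prodℕ n (λ i → frob (s ℕ.* i) η)

    Hpoly : ℕ → ℕ → Carrier → ℤ → (ℕ → Carrier) → QPol
    Hpoly k s η h a i =
      sumℕ k (λ j → mono (s ℕ.* j) (a j) i) + mono (s ℕ.* k) (η * frobℤ h (a 0)) i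

    H : ℕ → ℕ → Carrier → ℤ → Code
    H k s η h f = ∃[ a ] (f ≋ Hpoly k s η h a)

module Submission where

open import Defs
open import Level using (Level)
open import Data.Nat as ℕ using (ℕ; NonZero; _<_; _≤_)
open import Data.Nat.GCD using (gcd)
open import Data.Integer as ℤ using (+_)
open import Data.Product using (_×_)
open import Relation.Nullary using (¬_)
open import Relation.Binary.PropositionalEquality using (_≡_)
open import Algebra.Bundles using (CommutativeRing)

-- The equivalence is explicit: L₁ = η⁻¹ x^{q^{sk}}, L₂ = x, ρ = id.  The
-- adjoint f̂ has coefficient (f_{-i})^{q^i} at position i, so L₁ ∘ f̂ carries
-- η⁻¹ (f_{sk-i})^{q^i} at position i.  For f with coefficients a_j at s·j
-- (j < k) and η a_0^{q^h} at s·k this is again a member of H, with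
--   b_0 = a_0^{q^h},  b_j = η⁻¹ a_{k-j}^{q^{sj}} (0 < j < k),
--   top coefficient η⁻¹ a_0^{q^{sk}} = η⁻¹ b_0^{q^{sk-h}},
-- and a ↦ b can be inverted.  Positions are residues mod n and, s being a
-- unit mod n, every residue is s·j for exactly one j < n, which is how
-- coefficients are compared.  Frobenius exponents also live mod n, because
-- x^{q^n} = x in a field with q^n elements (Fermat).

module Congruence (n : ℕ) .{{_ : NonZero n}} where
  open import Data.Nat using (suc; _+_; _*_; _∸_)
  open import Data.Nat.DivMod
  open import Data.Nat.GCD using (gcd-GCD; module Bézout)
  open import Data.Nat.Solver using (module +-*-Solver)
  import Data.Nat.Properties as ℕₚ
  open import Algebra.Properties.CommutativeSemigroup ℕₚ.*-commutativeSemigroup using (x∙yz≈y∙xz)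
  import Data.Integer.Properties as ℤₚ
  open import Data.Integer.DivMod using (a≡a%ℕn+[a/ℕn]*n)
  open import Data.Integer.Solver renaming (module +-*-Solver to ℤ-Solver)
  open import Data.Product using (∃-syntax; _,_)
  open import Relation.Binary.PropositionalEquality using (refl; sym; trans; cong; cong₂; subst; module ≡-Reasoning)
  open ≡-Reasoning

  infix 4 _~_
  _~_ : ℕ → ℕ → Set
  a ~ b = a % n ≡ b % n

  ~-+ : ∀ {a a′ b b′} → a ~ a′ → b ~ b′ → a + b ~ a′ + b′
  ~-+ {a} {a′} {b} {b′} a~a′ b~b′ = begin
    (a + b) % n             ≡⟨ %-distribˡ-+ a b n ⟩
    (a % n + b % n) % n     ≡⟨ cong₂ (λ x y → (x + y) % n) a~a′ b~b′ ⟩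
    (a′ % n + b′ % n) % n   ≡⟨ sym (%-distribˡ-+ a′ b′ n) ⟩
    (a′ + b′) % n           ∎

  ~-* : ∀ {a a′ b b′} → a ~ a′ → b ~ b′ → a * b ~ a′ * b′
  ~-* {a} {a′} {b} {b′} a~a′ b~b′ = begin
    (a * b) % n             ≡⟨ %-distribˡ-* a b n ⟩
    (a % n * (b % n)) % n   ≡⟨ cong₂ (λ x y → (x * y) % n) a~a′ b~b′ ⟩
    (a′ % n * (b′ % n)) % n ≡⟨ sym (%-distribˡ-* a′ b′ n) ⟩
    (a′ * b′) % n           ∎

  ~-mod : ∀ a → a % n ~ a
  ~-mod a = m%n%n≡m%n a n

  multiple~0 : ∀ m → m * n ~ 0
  multiple~0 m = trans (m*n%n≡0 m n) (sym (m<n⇒m%n≡m (ℕ.>-nonZero⁻¹ n)))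

  n~0 : n ~ 0
  n~0 = trans (n%n≡0 n) (sym (m<n⇒m%n≡m (ℕ.>-nonZero⁻¹ n)))

  -- a ⊖ b is a representative of a - b modulo n
  infixl 6 _⊖_
  _⊖_ : ℕ → ℕ → ℕ
  a ⊖ b = a + (n ∸ b % n)

  ⊖-+ : ∀ a b → a ⊖ b + b ~ a
  ⊖-+ a b = begin
    (a + (n ∸ b % n) + b) % n         ≡⟨ ~-+ (refl {x = (a + (n ∸ b % n)) % n}) (sym (~-mod b)) ⟩
    (a + (n ∸ b % n) + b % n) % n     ≡⟨ cong (_% n) (ℕₚ.+-assoc a (n ∸ b % n) (b % n)) ⟩
    (a + ((n ∸ b % n) + b % n)) % n   ≡⟨ cong (λ x → (a + x) % n) (ℕₚ.m∸n+n≡m (m%n≤n b n)) ⟩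
    (a + n) % n                       ≡⟨ [m+n]%n≡m%n a n ⟩
    a % n                             ∎

  +⊖ : ∀ a c → a + c ⊖ c ~ a
  +⊖ a c = begin
    (a + c + (n ∸ c % n)) % n   ≡⟨ cong (_% n) (ℕₚ.+-assoc a c (n ∸ c % n)) ⟩
    (a + (c + (n ∸ c % n))) % n ≡⟨ cong (λ x → (a + x) % n) (ℕₚ.+-comm c (n ∸ c % n)) ⟩
    (a + (0 ⊖ c + c)) % n       ≡⟨ ~-+ (refl {x = a % n}) (⊖-+ 0 c) ⟩
    (a + 0) % n                 ≡⟨ cong (_% n) (ℕₚ.+-identityʳ a) ⟩
    a % n                       ∎

  ~-cancelʳ : ∀ {a b} c → a + c ~ b + c → a ~ b
  ~-cancelʳ {a} {b} c e = begin
    a % n           ≡˘⟨ +⊖ a c ⟩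
    (a + c ⊖ c) % n ≡⟨ ~-+ e (refl {x = (n ∸ c % n) % n}) ⟩
    (b + c ⊖ c) % n ≡⟨ +⊖ b c ⟩
    b % n           ∎

  ⊖-unique : ∀ {a′ a b} → a′ + b ~ a → a′ ~ a ⊖ b
  ⊖-unique {a′} {a} {b} e = ~-cancelʳ b (trans e (sym (⊖-+ a b)))

  ⊖~0 : ∀ {a b} → a ⊖ b ~ 0 → a ~ b
  ⊖~0 {a} {b} e = begin
    a % n           ≡˘⟨ ⊖-+ a b ⟩
    (a ⊖ b + b) % n ≡⟨ ~-+ e (refl {x = b % n}) ⟩
    (0 + b) % n     ∎

  -- i′ + i ~ M says that i′ is congruent to M - i = 0 - (i - M)
  ⊖-⊖ : ∀ {i′ i M} → i′ + i ~ M → i′ ~ 0 ⊖ (i ⊖ M)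
  ⊖-⊖ {i′} {i} {M} e = ⊖-unique (~-cancelʳ M (begin
    (i′ + (i ⊖ M) + M) % n   ≡⟨ cong (_% n) (ℕₚ.+-assoc i′ (i ⊖ M) M) ⟩
    (i′ + (i ⊖ M + M)) % n   ≡⟨ ~-+ (refl {x = i′ % n}) (⊖-+ i M) ⟩
    (i′ + i) % n             ≡⟨ e ⟩
    (0 + M) % n              ∎))

  scaled-difference : ∀ s {i′ j K} d → i′ + s * j ~ s * K → d + j ~ K → i′ ~ s * d
  scaled-difference s {i′} {j} {K} d e d+j~K = ~-cancelʳ (s * j) (begin
    (i′ + s * j) % n    ≡⟨ e ⟩
    (s * K) % n         ≡˘⟨ ~-* (refl {x = s % n}) d+j~K ⟩
    (s * (d + j)) % n   ≡⟨ cong (_% n) (ℕₚ.*-distribˡ-+ s d j) ⟩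
    (s * d + s * j) % n ∎)

  ~⇒≡ : ∀ {a b} → a < n → b < n → a ~ b → a ≡ b
  ~⇒≡ a<n b<n e = trans (sym (m<n⇒m%n≡m a<n)) (trans e (m<n⇒m%n≡m b<n))

  modular-inverse : ∀ s → gcd n s ≡ 1 → ∃[ t ] (s * t ~ 1)
  modular-inverse s g with subst (λ d → Bézout.Identity d n s) g (Bézout.identity (gcd-GCD n s))
  ... | Bézout.-+ x y eq = y , (begin
    (s * y) % n         ≡⟨ cong (_% n) (trans (ℕₚ.*-comm s y) (sym eq)) ⟩
    (1 + x * n) % n     ≡⟨ ~-+ (refl {x = 1 % n}) (multiple~0 x) ⟩
    (1 + 0) % n         ∎)
  ... | Bézout.+- x y eq = y * (n ∸ 1) , ~-cancelʳ (y * s) (begin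
    (s * (y * (n ∸ 1)) + y * s) % n   ≡⟨ cong (_% n) factor ⟩
    (y * s * n) % n                  ≡⟨ multiple~0 (y * s) ⟩
    0 % n                            ≡˘⟨ multiple~0 x ⟩
    (x * n) % n                      ≡˘⟨ cong (_% n) eq ⟩
    (1 + y * s) % n                  ∎)
    where
    open +-*-Solver using (_:*_; _:+_; _:=_; con)
    factor : s * (y * (n ∸ 1)) + y * s ≡ y * s * n
    factor = begin
      s * (y * (n ∸ 1)) + y * s   ≡⟨ +-*-Solver.solve 3 (λ s y m → s :* (y :* m) :+ y :* s := y :* s :* m :+ y :* s :* con 1) refl s y (n ∸ 1) ⟩
      y * s * (n ∸ 1) + y * s * 1 ≡˘⟨ ℕₚ.*-distribˡ-+ (y * s) (n ∸ 1) 1 ⟩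
      y * s * (n ∸ 1 + 1)         ≡⟨ cong (y * s *_) (ℕₚ.m∸n+n≡m (ℕ.>-nonZero⁻¹ n)) ⟩
      y * s * n                   ∎

  ℤ-multiple⇒~ : ∀ a b q → + a ≡ + b ℤ.+ q ℤ.* + n → a ~ b
  ℤ-multiple⇒~ a b (+ c) eq = begin
    a % n           ≡⟨ cong (_% n) (ℤₚ.+-injective (trans eq (sym embed))) ⟩
    (b + c * n) % n ≡⟨ [m+kn]%n≡m%n b c n ⟩
    b % n           ∎
    where
    embed : + (b + c * n) ≡ + b ℤ.+ + c ℤ.* + n
    embed = trans (ℤₚ.pos-+ b (c * n)) (cong (ℤ._+_ (+ b)) (ℤₚ.pos-* c n))
  ℤ-multiple⇒~ a b ℤ.-[1+ c ] eq = sym (begin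
    b % n               ≡⟨ cong (_% n) (ℤₚ.+-injective (sym embed)) ⟩
    (a + suc c * n) % n ≡⟨ [m+kn]%n≡m%n a (suc c) n ⟩
    a % n               ∎)
    where
    open ℤ-Solver using (_:+_; _:*_; :-_; _:=_)
    embed : + (a + suc c * n) ≡ + b
    embed = begin
      + (a + suc c * n)                           ≡⟨ trans (ℤₚ.pos-+ a (suc c * n)) (cong (ℤ._+_ (+ a)) (ℤₚ.pos-* (suc c) n)) ⟩
      + a ℤ.+ + suc c ℤ.* + n                     ≡⟨ cong (ℤ._+ + suc c ℤ.* + n) eq ⟩
      + b ℤ.+ ℤ.-[1+ c ] ℤ.* + n ℤ.+ + suc c ℤ.* + n ≡⟨ ℤ-Solver.solve 3 (λ B C N → B :+ (:- C) :* N :+ C :* N := B) refl (+ b) (+ suc c) (+ n) ⟩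
      + b                                         ∎

  +-difference : ∀ m h → h + ((+ m ℤ.- + h) ℤ.%ℕ n) ~ m
  +-difference m h = sym (ℤ-multiple⇒~ m (h + r) q (begin
    + m                            ≡⟨ ℤ-Solver.solve 2 (λ M H → M := H :+ (M :- H)) refl (+ m) (+ h) ⟩
    + h ℤ.+ z                      ≡⟨ cong (ℤ._+_ (+ h)) (a≡a%ℕn+[a/ℕn]*n z n) ⟩
    + h ℤ.+ (+ r ℤ.+ q ℤ.* + n)    ≡˘⟨ ℤₚ.+-assoc (+ h) (+ r) (q ℤ.* + n) ⟩
    + (h + r) ℤ.+ q ℤ.* + n        ∎))
    where
    open ℤ-Solver using (_:+_; _:-_; _:=_)
    z = + m ℤ.- + h
    r = z ℤ.%ℕ n
    q = z ℤ./ℕ n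

  -- multiplication by a unit s (with s·t ~ 1) permutes the residues mod n;
  -- `log i` is the residue j < n with s·j ~ i
  module Unit (s t : ℕ) (st~1 : s * t ~ 1) where

    ts-cancel : ∀ j → t * (s * j) ~ j
    ts-cancel j = begin
      (t * (s * j)) % n ≡˘⟨ cong (_% n) (ℕₚ.*-assoc t s j) ⟩
      (t * s * j) % n   ≡⟨ cong (λ x → (x * j) % n) (ℕₚ.*-comm t s) ⟩
      (s * t * j) % n   ≡⟨ ~-* st~1 (refl {x = j % n}) ⟩
      (1 * j) % n       ≡⟨ cong (_% n) (ℕₚ.*-identityˡ j) ⟩
      j % n             ∎

    log : ℕ → ℕ
    log i = (t * i) % n

    log<n : ∀ i → log i < n
    log<n i = m%n<n (t * i) n

    s*log : ∀ i → i ~ s * log i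
    s*log i = sym (begin
      (s * log i) % n     ≡⟨ ~-* (refl {x = s % n}) (~-mod (t * i)) ⟩
      (s * (t * i)) % n   ≡⟨ cong (_% n) (x∙yz≈y∙xz s t i) ⟩
      (t * (s * i)) % n   ≡⟨ ts-cancel i ⟩
      i % n               ∎)

    s*-injective : ∀ {j j′} → j < n → j′ < n → s * j ~ s * j′ → j ≡ j′
    s*-injective {j} {j′} j<n j′<n e = ~⇒≡ j<n j′<n (begin
      j % n             ≡˘⟨ ts-cancel j ⟩
      (t * (s * j)) % n  ≡⟨ ~-* (refl {x = t % n}) e ⟩
      (t * (s * j′)) % n ≡⟨ ts-cancel j′ ⟩
      j′ % n            ∎)

-- Power laws for the exponentiation `pow` of Defs, obtained from the
-- library's semiring exponentiation, with which it agrees definitionally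
-- clause by clause.
module PowerLaws {c ℓ : Level} (R : CommutativeRing c ℓ) where
  open CommutativeRing R
  open FiniteFieldTheory R using (pow)
  open import Data.Nat using (zero; suc)
  open import Algebra.Properties.Semiring.Exp semiring using (_^_; ^-congˡ; ^-assocʳ)
  import Relation.Binary.PropositionalEquality as ≡

  pow≡^ : ∀ x m → pow x m ≡ x ^ m
  pow≡^ x zero = ≡.refl
  pow≡^ x (suc m) = ≡.cong (x *_) (pow≡^ x m)

  pow-cong : ∀ {x y} m → x ≈ y → pow x m ≈ pow y m
  pow-cong {x} {y} m x≈y = ≡.subst₂ _≈_ (≡.sym (pow≡^ x m)) (≡.sym (pow≡^ y m)) (^-congˡ m x≈y)

  pow-pow : ∀ x a b → pow (pow x a) b ≈ pow x (a ℕ.* b)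
  pow-pow x a b = ≡.subst₂ _≈_
    (≡.sym (≡.trans (pow≡^ (pow x a) b) (≡.cong (_^ b) (pow≡^ x a)))) (≡.sym (pow≡^ x (a ℕ.* b)))
    (^-assocʳ x a b)

  pow-one : ∀ m → pow 1# m ≈ 1#
  pow-one zero = refl
  pow-one (suc m) = trans (*-identityˡ _) (pow-one m)

  pow-zero : ∀ m → .{{NonZero m}} → pow 0# m ≈ 0#
  pow-zero (suc m) = zeroˡ _

  pow-1 : ∀ x → pow x 1 ≈ x
  pow-1 = *-identityʳ

-- Multiplication by a nonzero x permutes the nonzero elements,
-- so their product P satisfies P = x ^ (N - 1) · P with P invertible.
module FiniteFieldFacts {c ℓ : Level} (F : CommutativeRing c ℓ)
                        (isField : FiniteFieldTheory.IsField F) where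
  open CommutativeRing F hiding (zero)
  open FiniteFieldTheory F using (pow; HasCardinality)
  open import Data.Nat using (zero; suc)
  open import Data.Fin as Fin using (Fin; punchIn; punchOut; _≟_)
  open import Function using (_∘_)
  open import Level using (_⊔_)
  open import Relation.Binary.PropositionalEquality using (_≢_)
  open import Data.Fin.Properties using (punchIn-injective; punchInᵢ≢i; punchIn-punchOut)
  import Data.Fin.Permutation as Perm
  open import Data.Product using (∃-syntax; _,_; proj₁; proj₂)
  open import Relation.Nullary using (Dec; yes; no)
  import Relation.Binary.PropositionalEquality as ≡
  open import Relation.Binary.Reasoning.Setoid setoid
  open import Algebra.Properties.CommutativeMonoid.Sum *-commutativeMonoid
    using (sum-permute; ∑-distrib-+; sum-cong-≋) renaming (sum to prod)

  inverse : ∀ x → ¬ (x ≈ 0#) → Carrier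
  inverse x x≉0 = proj₁ (proj₂ isField x x≉0)

  inverse-right : ∀ x x≉0 → x * inverse x x≉0 ≈ 1#
  inverse-right x x≉0 = proj₂ (proj₂ isField x x≉0)

  inverse-left : ∀ x x≉0 → inverse x x≉0 * x ≈ 1#
  inverse-left x x≉0 = trans (*-comm _ _) (inverse-right x x≉0)

  cancel-left : ∀ {u v y} → u * v ≈ 1# → u * (v * y) ≈ y
  cancel-left {u} {v} {y} uv≈1 = begin
    u * (v * y) ≈⟨ sym (*-assoc u v y) ⟩
    u * v * y   ≈⟨ *-congʳ uv≈1 ⟩
    1# * y      ≈⟨ *-identityˡ y ⟩
    y           ∎

  inverse-nonzero : ∀ x x≉0 → ¬ (inverse x x≉0 ≈ 0#)
  inverse-nonzero x x≉0 x⁻¹≈0 = proj₁ isField (begin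
    1#                   ≈⟨ sym (inverse-right x x≉0) ⟩
    x * inverse x x≉0    ≈⟨ *-congˡ x⁻¹≈0 ⟩
    x * 0#               ≈⟨ zeroʳ x ⟩
    0#                   ∎)

  *-nonzero : ∀ {x y} → ¬ (x ≈ 0#) → ¬ (y ≈ 0#) → ¬ (x * y ≈ 0#)
  *-nonzero {x} {y} x≉0 y≉0 xy≈0 = y≉0 (begin
    y                        ≈⟨ sym (cancel-left (inverse-left x x≉0)) ⟩
    inverse x x≉0 * (x * y)  ≈⟨ *-congˡ xy≈0 ⟩
    inverse x x≉0 * 0#       ≈⟨ zeroʳ _ ⟩
    0#                       ∎)

  prod-nonzero : ∀ {M} (u : Fin M → Carrier) → (∀ j → ¬ (u j ≈ 0#)) → ¬ (prod u ≈ 0#)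
  prod-nonzero {zero} u u≉0 = proj₁ isField
  prod-nonzero {suc M} u u≉0 = *-nonzero (u≉0 Fin.zero) (prod-nonzero (u ∘ Fin.suc) (u≉0 ∘ Fin.suc))

  prod-const : ∀ M x → prod {M} (λ _ → x) ≈ pow x M
  prod-const zero x = refl
  prod-const (suc M) x = *-congˡ (prod-const M x)

  record NonzeroEnumeration (M : ℕ) : Set (c ⊔ ℓ) where
    field
      elem      : Fin M → Carrier
      nonzero   : ∀ j → ¬ (elem j ≈ 0#)
      injective : ∀ i j → elem i ≈ elem j → i ≡ j
      covers    : ∀ y → ¬ (y ≈ 0#) → ∃[ j ] (elem j ≈ y)

  -- removing the index of 0 from an enumeration of all N = M + 1 elements
  nonzero-enumeration : ∀ {M} → HasCardinality (suc M) → NonzeroEnumeration M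
  nonzero-enumeration {M} (e , e-injective , e-covers) = record
    { elem = λ j → e (punchIn z j)
    ; nonzero = λ j e≈0 → punchInᵢ≢i z j (e-injective _ _ (trans e≈0 (sym (index-spec 0#))))
    ; injective = λ i j eq → punchIn-injective z i j (e-injective _ _ eq)
    ; covers = λ y y≉0 → punchOut (z≢index y≉0) ,
                         trans (reflexive (≡.cong e (punchIn-punchOut (z≢index y≉0)))) (index-spec y)
    }
    where
    index : Carrier → Fin (suc M)
    index y = proj₁ (e-covers y)
    index-spec : ∀ y → e (index y) ≈ y
    index-spec y = proj₂ (e-covers y)
    z : Fin (suc M)
    z = index 0#
    z≢index : ∀ {y} → ¬ (y ≈ 0#) → z ≢ index y
    z≢index {y} y≉0 z≡index = y≉0 (begin
      y         ≈⟨ sym (index-spec y) ⟩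
      e (index y) ≡⟨ ≡.cong e (≡.sym z≡index) ⟩
      e z       ≈⟨ index-spec 0# ⟩
      0#        ∎)

  unit-power : ∀ {M} → NonzeroEnumeration M → ∀ x → ¬ (x ≈ 0#) → pow x M ≈ 1#
  unit-power {M} enum x x≉0 = begin
    pow x M                ≈⟨ sym (*-identityʳ _) ⟩
    pow x M * 1#           ≈⟨ *-congˡ (sym (inverse-right P P≉0)) ⟩
    pow x M * (P * P⁻¹)    ≈⟨ sym (*-assoc _ _ _) ⟩
    pow x M * P * P⁻¹      ≈⟨ *-congʳ (sym P≈xᴹP) ⟩
    P * P⁻¹                ≈⟨ inverse-right P P≉0 ⟩
    1#                     ∎
    where
    open NonzeroEnumeration enum
    scale : ∀ y → ¬ (y ≈ 0#) → Fin M → Fin M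
    scale y y≉0 j = proj₁ (covers (y * elem j) (*-nonzero y≉0 (nonzero j)))
    scale-spec : ∀ y y≉0 j → elem (scale y y≉0 j) ≈ y * elem j
    scale-spec y y≉0 j = proj₂ (covers (y * elem j) (*-nonzero y≉0 (nonzero j)))
    scale-inverse : ∀ u u≉0 y y≉0 → u * y ≈ 1# → ∀ j → scale u u≉0 (scale y y≉0 j) ≡ j
    scale-inverse u u≉0 y y≉0 uy≈1 j = injective _ _ (begin
      elem (scale u u≉0 (scale y y≉0 j)) ≈⟨ scale-spec u u≉0 _ ⟩
      u * elem (scale y y≉0 j)           ≈⟨ *-congˡ (scale-spec y y≉0 j) ⟩
      u * (y * elem j)                   ≈⟨ cancel-left uy≈1 ⟩
      elem j                             ∎)
    x⁻¹ = inverse x x≉0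
    x⁻¹≉0 = inverse-nonzero x x≉0
    π : Perm.Permutation M M
    π = Perm.permutation (scale x x≉0) (scale x⁻¹ x⁻¹≉0)
          (scale-inverse x x≉0 x⁻¹ x⁻¹≉0 (inverse-right x x≉0))
          (scale-inverse x⁻¹ x⁻¹≉0 x x≉0 (inverse-left x x≉0))
    P = prod elem
    P≉0 = prod-nonzero elem nonzero
    P⁻¹ = inverse P P≉0
    P≈xᴹP : P ≈ pow x M * P
    P≈xᴹP = begin
      P                                 ≈⟨ sum-permute elem π ⟩
      prod (λ j → elem (scale x x≉0 j)) ≈⟨ sum-cong-≋ (scale-spec x x≉0) ⟩
      prod (λ j → x * elem j)           ≈⟨ ∑-distrib-+ (λ _ → x) elem ⟩
      prod {M} (λ _ → x) * P            ≈⟨ *-congʳ (prod-const M x) ⟩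
      pow x M * P                       ∎

  ≈0? : ∀ {N} → HasCardinality N → ∀ x → Dec (x ≈ 0#)
  ≈0? (e , e-injective , e-covers) x with proj₁ (e-covers x) ≟ proj₁ (e-covers 0#)
  ... | yes eq = yes (trans (sym (proj₂ (e-covers x))) (trans (reflexive (≡.cong e eq)) (proj₂ (e-covers 0#))))
  ... | no neq = no (λ x≈0 → neq (e-injective _ _
                  (trans (proj₂ (e-covers x)) (trans x≈0 (sym (proj₂ (e-covers 0#)))))))

  fermat : ∀ N → HasCardinality N → ∀ x → pow x N ≈ x
  fermat zero (_ , _ , e-covers) x with e-covers x
  ... | () , _
  fermat (suc M) card x with ≈0? card x
  ... | yes x≈0 = trans (*-congʳ x≈0) (trans (zeroˡ _) (sym x≈0))
  ... | no x≉0 = trans (*-congˡ (unit-power (nonzero-enumeration card) x x≉0)) (*-identityʳ x)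

module Coefficients {c ℓ : Level} (R : CommutativeRing c ℓ) (q n : ℕ) .{{_ : NonZero n}} where
  open CommutativeRing R hiding (zero)
  open FiniteFieldTheory R
  open QPoly q n
  open Congruence n
  open import Data.Nat using (zero; suc; _%_)
  open import Data.Nat.DivMod using (m%n<n; m<n⇒m%n≡m)
  import Data.Nat.Properties as ℕₚ
  open import Data.Fin as Fin using (Fin; toℕ)
  import Data.Fin.Properties as Finₚ
  open import Relation.Nullary using (yes; no)
  open import Data.Empty using (⊥-elim)
  import Relation.Binary.PropositionalEquality as ≡
  open import Relation.Binary.PropositionalEquality using (_≢_; ≢-sym)
  open import Relation.Binary.Reasoning.Setoid setoid

  sum-cong : ∀ K {f g : ℕ → Carrier} → (∀ j → j < K → f j ≈ g j) → sumℕ K f ≈ sumℕ K g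
  sum-cong zero f≈g = refl
  sum-cong (suc K) f≈g = +-cong (sum-cong K (λ j j<K → f≈g j (ℕₚ.m<n⇒m<1+n j<K))) (f≈g K (ℕₚ.n<1+n K))

  sum-zero : ∀ K {f : ℕ → Carrier} → (∀ j → j < K → f j ≈ 0#) → sumℕ K f ≈ 0#
  sum-zero zero f≈0 = refl
  sum-zero (suc K) f≈0 =
    trans (+-cong (sum-zero K (λ j j<K → f≈0 j (ℕₚ.m<n⇒m<1+n j<K))) (f≈0 K (ℕₚ.n<1+n K))) (+-identityˡ _)

  sum-single : ∀ K {f : ℕ → Carrier} j₀ → j₀ < K → (∀ j → j < K → j ≢ j₀ → f j ≈ 0#) → sumℕ K f ≈ f j₀
  sum-single (suc K) j₀ j₀<1+K others with j₀ ℕ.≟ K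
  ... | yes ≡.refl = trans (+-cong (sum-zero K (λ j j<K → others j (ℕₚ.m<n⇒m<1+n j<K) (ℕₚ.<⇒≢ j<K))) refl)
                           (+-identityˡ _)
  ... | no j₀≢K = trans (+-cong (sum-single K j₀ (ℕₚ.≤∧≢⇒< (ℕₚ.≤-pred j₀<1+K) j₀≢K)
                                   (λ j j<K → others j (ℕₚ.m<n⇒m<1+n j<K)))
                                (others K (ℕₚ.n<1+n K) (≢-sym j₀≢K)))
                        (+-identityʳ _)

  position : ℕ → Fin n
  position i = Fin.fromℕ< (m%n<n i n)

  toℕ-position : ∀ i → toℕ (position i) ≡ i % n
  toℕ-position i = Finₚ.toℕ-fromℕ< (m%n<n i n)

  coeff-~ : ∀ f {i j} → i ~ j → coeff f i ≡ coeff f j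
  coeff-~ f {i} {j} i~j = ≡.cong f (Finₚ.fromℕ<-cong (i % n) (j % n) i~j (m%n<n i n) (m%n<n j n))

  coeff-toℕ : ∀ f (x : Fin n) → coeff f (toℕ x) ≡ f x
  coeff-toℕ f x = ≡.cong f (≡.trans (Finₚ.fromℕ<-cong _ _ (m<n⇒m%n≡m (Finₚ.toℕ<n x)) _ (Finₚ.toℕ<n x))
                                    (Finₚ.fromℕ<-toℕ x (Finₚ.toℕ<n x)))

  coeff⇒≋ : ∀ {f g} → (∀ i → coeff f i ≈ coeff g i) → f ≋ g
  coeff⇒≋ {f} {g} f≈g x = begin
    f x            ≡˘⟨ coeff-toℕ f x ⟩
    coeff f (toℕ x) ≈⟨ f≈g (toℕ x) ⟩
    coeff g (toℕ x) ≡⟨ coeff-toℕ g x ⟩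
    g x            ∎

  coeff-mono-match : ∀ M a {i} → i ~ M → coeff (mono M a) i ≈ a
  coeff-mono-match M a {i} i~M with toℕ (position i) ℕ.≟ M % n
  ... | yes _ = refl
  ... | no mismatch = ⊥-elim (mismatch (≡.trans (toℕ-position i) i~M))

  coeff-mono-miss : ∀ M a {i} → ¬ (i ~ M) → coeff (mono M a) i ≈ 0#
  coeff-mono-miss M a {i} i≁M with toℕ (position i) ℕ.≟ M % n
  ... | yes match = ⊥-elim (i≁M (≡.trans (≡.sym (toℕ-position i)) match))
  ... | no _ = refl

  sum-against-mono : ∀ M a (g : ℕ → Carrier) → sumℕ n (λ j → coeff (mono M a) j * g j) ≈ a * g (M % n)
  sum-against-mono M a g =
    trans (sum-single n (M % n) (m%n<n M n)
             (λ j j<n j≢ → trans (*-congʳ (coeff-mono-miss M a (λ j~M → j≢ (≡.trans (≡.sym (m<n⇒m%n≡m j<n)) j~M))))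
                                 (zeroˡ _)))
          (*-congʳ (coeff-mono-match M a (~-mod M)))

  mono-cong : ∀ M {a a′} (x : Fin n) → a ≈ a′ → mono M a x ≈ mono M a′ x
  mono-cong M x a≈a′ with toℕ x ℕ.≟ M % n
  ... | yes _ = a≈a′
  ... | no _ = refl

  module SpanningCoefficients (s t : ℕ) (st~1 : s ℕ.* t ~ 1) (k : ℕ) (k<n : k < n) where
    open Unit s t st~1 using (s*-injective)

    mono-s-miss : ∀ {i j j′} (a : Carrier) → j < n → j′ < n → j′ ≢ j → i ~ s ℕ.* j → coeff (mono (s ℕ.* j′) a) i ≈ 0#
    mono-s-miss a j<n j′<n j′≢j i~sj =
      coeff-mono-miss _ a (λ i~sj′ → j′≢j (s*-injective j′<n j<n (≡.trans (≡.sym i~sj′) i~sj)))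

    Σ-below : ∀ (a : ℕ → Carrier) {i j} → j < k → i ~ s ℕ.* j → sumℕ k (λ j′ → coeff (mono (s ℕ.* j′) (a j′)) i) ≈ a j
    Σ-below a j<k i~sj = trans
      (sum-single k _ j<k (λ j′ j′<k j′≢j → mono-s-miss (a j′) (ℕₚ.<-trans j<k k<n) (ℕₚ.<-trans j′<k k<n) j′≢j i~sj))
      (coeff-mono-match _ (a _) i~sj)

    Σ-above : ∀ (a : ℕ → Carrier) {i j} → k ≤ j → j < n → i ~ s ℕ.* j → sumℕ k (λ j′ → coeff (mono (s ℕ.* j′) (a j′)) i) ≈ 0#
    Σ-above a k≤j j<n i~sj =
      sum-zero k (λ j′ j′<k → mono-s-miss (a j′) j<n (ℕₚ.<-trans j′<k k<n) (ℕₚ.<⇒≢ (ℕₚ.<-≤-trans j′<k k≤j)) i~sj)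

    coeff-Hpoly-below : ∀ e hh (a : ℕ → Carrier) {i j} → j < k → i ~ s ℕ.* j → coeff (Hpoly k s e hh a) i ≈ a j
    coeff-Hpoly-below e hh a j<k i~sj = trans
      (+-cong (Σ-below a j<k i~sj) (mono-s-miss _ (ℕₚ.<-trans j<k k<n) k<n (ℕₚ.>⇒≢ j<k) i~sj))
      (+-identityʳ _)

    coeff-Hpoly-top : ∀ e hh (a : ℕ → Carrier) {i} → i ~ s ℕ.* k → coeff (Hpoly k s e hh a) i ≈ e * frobℤ hh (a 0)
    coeff-Hpoly-top e hh a i~sk = trans
      (+-cong (Σ-above a ℕₚ.≤-refl k<n i~sk) (coeff-mono-match _ _ i~sk))
      (+-identityˡ _)

    coeff-Hpoly-above : ∀ e hh (a : ℕ → Carrier) {i j} → k < j → j < n → i ~ s ℕ.* j → coeff (Hpoly k s e hh a) i ≈ 0#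
    coeff-Hpoly-above e hh a k<j j<n i~sj = trans
      (+-cong (Σ-above a (ℕₚ.<⇒≤ k<j) j<n i~sj) (mono-s-miss _ j<n k<n (ℕₚ.<⇒≢ k<j) i~sj))
      (+-identityˡ _)

    Hpoly-cong : 1 ≤ k → ∀ e hh {a a′} → (∀ j → j < k → a j ≈ a′ j) → Hpoly k s e hh a ≋ Hpoly k s e hh a′
    Hpoly-cong k≥1 e hh a≈a′ x = +-cong (sum-cong k (λ j j<k → mono-cong (s ℕ.* j) x (a≈a′ j j<k)))
      (mono-cong (s ℕ.* k) x (*-congˡ (PowerLaws.pow-cong R (q ℕ.^ (hh ℤ.%ℕ n)) (a≈a′ 0 k≥1))))

module QPolyCalculus {c ℓ : Level} (F : CommutativeRing c ℓ)
                     (isField : FiniteFieldTheory.IsField F)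
                     (q n : ℕ) .{{_ : NonZero q}} .{{_ : NonZero n}}
                     (card : FiniteFieldTheory.HasCardinality F (q ℕ.^ n)) where
  open CommutativeRing F hiding (zero)
  open FiniteFieldTheory F
  open QPoly q n
  open Congruence n
  open PowerLaws F
  open Coefficients F q n
  open import Data.Nat using (zero; suc; _∸_; _%_; _/_)
  open import Data.Nat.DivMod using (m≡m%n+[m/n]*n; m<n⇒m%n≡m)
  import Data.Nat.Properties as ℕₚ
  open import Data.Fin as Fin using (toℕ)
  import Data.Fin.Properties as Finₚ
  import Relation.Binary.PropositionalEquality as ≡
  open import Relation.Binary.PropositionalEquality using (_≢_)
  open import Data.Product using (∃-syntax; _,_)
  open import Relation.Binary.Reasoning.Setoid setoid

  frob-cong : ∀ i {x y} → x ≈ y → frob i x ≈ frob i y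
  frob-cong i = pow-cong (q ℕ.^ i)

  frob-frob : ∀ a b x → frob a (frob b x) ≈ frob (b ℕ.+ a) x
  frob-frob a b x = trans (pow-pow x (q ℕ.^ b) (q ℕ.^ a))
                          (reflexive (≡.cong (pow x) (≡.sym (ℕₚ.^-distribˡ-+-* q b a))))

  frob-0 : ∀ x → frob 0 x ≈ x
  frob-0 = pow-1

  frob-0# : ∀ i → frob i 0# ≈ 0#
  frob-0# i = pow-zero (q ℕ.^ i) {{ℕₚ.m^n≢0 q i}}

  frob-1# : ∀ i → frob i 1# ≈ 1#
  frob-1# i = pow-one (q ℕ.^ i)

  frob-n : ∀ x → frob n x ≈ x
  frob-n = FiniteFieldFacts.fermat F isField (q ℕ.^ n) card

  frob-+multiple : ∀ i m x → frob (i ℕ.+ m ℕ.* n) x ≈ frob i x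
  frob-+multiple i zero x = reflexive (≡.cong (λ j → frob j x) (ℕₚ.+-identityʳ i))
  frob-+multiple i (suc m) x = begin
    frob (i ℕ.+ (n ℕ.+ m ℕ.* n)) x  ≡⟨ ≡.cong (λ j → frob j x) (ℕₚ.+-comm i (n ℕ.+ m ℕ.* n)) ⟩
    frob (n ℕ.+ m ℕ.* n ℕ.+ i) x    ≡⟨ ≡.cong (λ j → frob j x) (ℕₚ.+-assoc n (m ℕ.* n) i) ⟩
    frob (n ℕ.+ (m ℕ.* n ℕ.+ i)) x  ≈⟨ sym (frob-frob _ n x) ⟩
    frob (m ℕ.* n ℕ.+ i) (frob n x) ≈⟨ frob-cong (m ℕ.* n ℕ.+ i) (frob-n x) ⟩
    frob (m ℕ.* n ℕ.+ i) x          ≡⟨ ≡.cong (λ j → frob j x) (ℕₚ.+-comm (m ℕ.* n) i) ⟩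
    frob (i ℕ.+ m ℕ.* n) x          ≈⟨ frob-+multiple i m x ⟩
    frob i x                        ∎

  frob-mod : ∀ i x → frob i x ≈ frob (i % n) x
  frob-mod i x = trans (reflexive (≡.cong (λ j → frob j x) (m≡m%n+[m/n]*n i n)))
                       (frob-+multiple (i % n) (i / n) x)

  frob-~ : ∀ {i j} x → i ~ j → frob i x ≈ frob j x
  frob-~ {i} {j} x i~j = begin
    frob i x       ≈⟨ frob-mod i x ⟩
    frob (i % n) x ≡⟨ ≡.cong (λ k → frob k x) i~j ⟩
    frob (j % n) x ≈⟨ sym (frob-mod j x) ⟩
    frob j x       ∎

  frob-⊖ˡ : ∀ m x → frob m (frob (0 ⊖ m) x) ≈ x
  frob-⊖ˡ m x = trans (frob-frob m (0 ⊖ m) x) (trans (frob-~ x (⊖-+ 0 m)) (frob-0 x))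

  frob-⊖ʳ : ∀ m x → frob (0 ⊖ m) (frob m x) ≈ x
  frob-⊖ʳ m x = trans (frob-frob (0 ⊖ m) m x)
                      (trans (frob-~ x (≡.trans (≡.cong (_% n) (ℕₚ.+-comm m (0 ⊖ m))) (⊖-+ 0 m))) (frob-0 x))

  frobℤ-pos : ∀ m x → frobℤ (+ m) x ≈ frob m x
  frobℤ-pos m x = sym (frob-mod m x)

  frobℤ-difference : ∀ m h x → frobℤ (+ m ℤ.- + h) (frob h x) ≈ frob m x
  frobℤ-difference m h x = trans (frob-frob _ h x) (frob-~ x (+-difference m h))


  eval-mono : ∀ M a x → eval (mono M a) x ≈ a * frob M x
  eval-mono M a x = trans (sum-against-mono M a (λ j → frob j x)) (*-congˡ (sym (frob-mod M x)))

  coeff-mono-∘ : ∀ M a G i → coeff (mono M a ∘P G) i ≈ a * frob M (coeff G (i ⊖ M))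
  coeff-mono-∘ M a G i = begin
    coeff (mono M a ∘P G) i                                    ≈⟨ sum-against-mono M a _ ⟩
    a * frob (M % n) (coeff G (toℕ (position i) ℕ.+ (n ∸ M % n))) ≈⟨ *-congˡ (sym (frob-mod M _)) ⟩
    a * frob M (coeff G (toℕ (position i) ℕ.+ (n ∸ M % n)))       ≡⟨ ≡.cong (λ y → a * frob M y) (coeff-~ G index~) ⟩
    a * frob M (coeff G (i ⊖ M))                               ∎
    where
    index~ : toℕ (position i) ℕ.+ (n ∸ M % n) ~ i ⊖ M
    index~ = ~-+ (≡.trans (≡.cong (_% n) (toℕ-position i)) (~-mod i)) ≡.refl

  coeff-∘-x : ∀ G i → coeff (G ∘P mono 0 1#) i ≈ coeff G i
  coeff-∘-x G i = begin
    coeff (G ∘P mono 0 1#) i                       ≈⟨ sum-single n X (Finₚ.toℕ<n (position i)) others ⟩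
    coeff G X * frob X (coeff (mono 0 1#) (X ℕ.+ (n ∸ X))) ≈⟨ *-congˡ (trans (frob-cong X (coeff-mono-match 0 1# X⊖X~0)) (frob-1# X)) ⟩
    coeff G X * 1#                                 ≈⟨ *-identityʳ _ ⟩
    coeff G X                                      ≡⟨ coeff-~ G (≡.trans (≡.cong (_% n) (toℕ-position i)) (~-mod i)) ⟩
    coeff G i                                      ∎
    where
    X = toℕ (position i)
    as-⊖ : ∀ {j} → j < n → X ℕ.+ (n ∸ j) ≡ X ⊖ j
    as-⊖ j<n = ≡.cong (λ r → X ℕ.+ (n ∸ r)) (≡.sym (m<n⇒m%n≡m j<n))
    X⊖X~0 : X ℕ.+ (n ∸ X) ~ 0
    X⊖X~0 = ≡.trans (≡.cong (_% n) (ℕₚ.m+[n∸m]≡n (ℕₚ.<⇒≤ (Finₚ.toℕ<n (position i))))) n~0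
    others : ∀ j → j < n → j ≢ X → coeff G j * frob j (coeff (mono 0 1#) (X ℕ.+ (n ∸ j))) ≈ 0#
    others j j<n j≢X = trans (*-congˡ (trans (frob-cong j (coeff-mono-miss 0 1# X⊖j≁0)) (frob-0# j))) (zeroʳ _)
      where
      X⊖j≁0 : ¬ (X ℕ.+ (n ∸ j) ~ 0)
      X⊖j≁0 e = j≢X (≡.sym (~⇒≡ (Finₚ.toℕ<n (position i)) j<n (⊖~0 (≡.subst (_~ 0) (as-⊖ j<n) e))))

  coeff-adjoint : ∀ f i → coeff (adjoint f) i ≈ frob i (coeff f (0 ⊖ i))
  coeff-adjoint f i = begin
    frob (toℕ (position i)) (coeff f (n ∸ toℕ (position i))) ≡⟨ ≡.cong (λ r → frob r (coeff f (n ∸ r))) (toℕ-position i) ⟩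
    frob (i % n) (coeff f (0 ⊖ i))                           ≈⟨ sym (frob-mod i _) ⟩
    frob i (coeff f (0 ⊖ i))                                 ∎

  coeff-twisted-adjoint : ∀ M a f g → f ≋ adjoint g → ∀ {i i′} → i′ ℕ.+ i ~ M →
                          coeff (mono M a ∘P (f ∘P mono 0 1#)) i ≈ a * frob i (coeff g i′)
  coeff-twisted-adjoint M a f g f≋ĝ {i} {i′} e = begin
    coeff (mono M a ∘P (f ∘P mono 0 1#)) i                ≈⟨ coeff-mono-∘ M a (f ∘P mono 0 1#) i ⟩
    a * frob M (coeff (f ∘P mono 0 1#) (i ⊖ M))            ≈⟨ *-congˡ (frob-cong M (trans (coeff-∘-x f (i ⊖ M)) (f≋ĝ _))) ⟩
    a * frob M (coeff (adjoint g) (i ⊖ M))                 ≈⟨ *-congˡ (frob-cong M (coeff-adjoint g (i ⊖ M))) ⟩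
    a * frob M (frob (i ⊖ M) (coeff g (0 ⊖ (i ⊖ M))))      ≈⟨ *-congˡ (frob-frob M (i ⊖ M) _) ⟩
    a * frob (i ⊖ M ℕ.+ M) (coeff g (0 ⊖ (i ⊖ M)))         ≈⟨ *-congˡ (frob-~ _ (⊖-+ i M)) ⟩
    a * frob i (coeff g (0 ⊖ (i ⊖ M)))                     ≡˘⟨ ≡.cong (λ y → a * frob i y) (coeff-~ g (⊖-⊖ e)) ⟩
    a * frob i (coeff g i′)                                ∎

  mono-permutation : ∀ M {a b} → b * a ≈ 1# → IsPermutationQPol (mono M a)
  mono-permutation M {a} {b} ba≈1 = injective , surjective
    where
    open FiniteFieldFacts F isField using (cancel-left)
    injective : ∀ x y → eval (mono M a) x ≈ eval (mono M a) y → x ≈ y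
    injective x y e = begin
      x                          ≈⟨ sym (frob-⊖ʳ M x) ⟩
      frob (0 ⊖ M) (frob M x)    ≈⟨ frob-cong (0 ⊖ M) (sym (cancel-left ba≈1)) ⟩
      frob (0 ⊖ M) (b * (a * frob M x)) ≈⟨ frob-cong (0 ⊖ M) (*-congˡ (trans (sym (eval-mono M a x)) (trans e (eval-mono M a y)))) ⟩
      frob (0 ⊖ M) (b * (a * frob M y)) ≈⟨ frob-cong (0 ⊖ M) (cancel-left ba≈1) ⟩
      frob (0 ⊖ M) (frob M y)    ≈⟨ frob-⊖ʳ M y ⟩
      y                          ∎
    surjective : ∀ y → ∃[ x ] (eval (mono M a) x ≈ y)
    surjective y = frob (0 ⊖ M) (b * y) , (begin
      eval (mono M a) (frob (0 ⊖ M) (b * y))  ≈⟨ eval-mono M a _ ⟩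
      a * frob M (frob (0 ⊖ M) (b * y))       ≈⟨ *-congˡ (frob-⊖ˡ M (b * y)) ⟩
      a * (b * y)                             ≈⟨ cancel-left (trans (*-comm a b) ba≈1) ⟩
      y                                       ∎)

  identity-automorphism : IsAutomorphism (λ x → x)
  identity-automorphism = (λ e → e) , (λ _ _ → refl) , (λ _ _ → refl) , refl , (λ _ _ e → e) , (λ y → y , refl)

module AdjointEquivalence {c ℓ : Level} (F : CommutativeRing c ℓ)
                          (isField : FiniteFieldTheory.IsField F)
                          (q n : ℕ) .{{_ : NonZero q}} .{{_ : NonZero n}}
                          (card : FiniteFieldTheory.HasCardinality F (q ℕ.^ n))
                          (k s t : ℕ) (st~1 : Congruence._~_ n (s ℕ.* t) 1)
                          (k≥1 : 1 ≤ k) (k<n : k < n) (h : ℕ) where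
  open CommutativeRing F hiding (zero)
  open FiniteFieldTheory F
  open QPoly q n
  open Congruence n
  open Congruence.Unit n s t st~1 using (log; log<n; s*log)
  open Coefficients F q n
  open Coefficients.SpanningCoefficients F q n s t st~1 k k<n
  open QPolyCalculus F isField q n card
  open FiniteFieldFacts F isField using (cancel-left)
  open import Data.Nat using (zero; suc; _∸_; _%_)
  open import Data.Nat.DivMod using ([m+n]%n≡m%n)
  import Data.Nat.Properties as ℕₚ
  open import Data.Integer using (ℤ)
  open import Data.Product using (∃-syntax; _,_; _×_)
  open import Relation.Binary.Definitions using (tri<; tri≈; tri>)
  import Relation.Binary.PropositionalEquality as ≡
  open import Relation.Binary.Reasoning.Setoid setoid

  module _ (η η⁻¹ : Carrier) (ηη⁻¹≈1 : η * η⁻¹ ≈ 1#) where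

    η⁻¹η≈1 : η⁻¹ * η ≈ 1#
    η⁻¹η≈1 = trans (*-comm η⁻¹ η) ηη⁻¹≈1

    h′ : ℤ
    h′ = + (s ℕ.* k) ℤ.- + h

    Source Target : (ℕ → Carrier) → QPol
    Source a = Hpoly k s η (+ h) a
    Target b = Hpoly k s η⁻¹ h′ b

    L₁ L₂ : QPol
    L₁ = mono (s ℕ.* k) η⁻¹
    L₂ = mono 0 1#

    -- f ↦ L₁ ∘ f^ρ ∘ L₂ for ρ = id (mapCoeff (λ x → x) f is f itself)
    twist : QPol → QPol
    twist f = L₁ ∘P (f ∘P L₂)

    -- the coefficients b of twist (adjoint (Source a)) as a member of H_{k,s}(η⁻¹,sk-h)
    transformed : (ℕ → Carrier) → ℕ → Carrier
    transformed a zero = frob h (a 0)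
    transformed a (suc j) = η⁻¹ * frob (s ℕ.* suc j) (a (k ∸ suc j))

    untransformed : (ℕ → Carrier) → ℕ → Carrier
    untransformed b zero = frob (0 ⊖ h) (b 0)
    untransformed b (suc d) = frob (0 ⊖ (s ℕ.* (k ∸ suc d))) (η * b (k ∸ suc d))

    untransformed-at : ∀ b {j} → j < k → untransformed b (k ∸ j) ≡ frob (0 ⊖ (s ℕ.* j)) (η * b j)
    untransformed-at b {j} j<k with k ∸ j | ℕₚ.m<n⇒0<n∸m j<k | ℕₚ.m∸[m∸n]≡n (ℕₚ.<⇒≤ j<k)
    ... | suc d | _ | k∸[1+d]≡j = ≡.cong (λ m → frob (0 ⊖ (s ℕ.* m)) (η * b m)) k∸[1+d]≡j

    transformed-untransformed : ∀ b j → j < k → transformed (untransformed b) j ≈ b j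
    transformed-untransformed b zero _ = frob-⊖ˡ h (b 0)
    transformed-untransformed b (suc j) j<k = begin
      η⁻¹ * frob (s ℕ.* suc j) (untransformed b (k ∸ suc j))              ≡⟨ ≡.cong (λ y → η⁻¹ * frob (s ℕ.* suc j) y) (untransformed-at b j<k) ⟩
      η⁻¹ * frob (s ℕ.* suc j) (frob (0 ⊖ (s ℕ.* suc j)) (η * b (suc j))) ≈⟨ *-congˡ (frob-⊖ˡ (s ℕ.* suc j) _) ⟩
      η⁻¹ * (η * b (suc j))                                               ≈⟨ cancel-left η⁻¹η≈1 ⟩
      b (suc j)                                                           ∎

    -- Comparison of coefficients at a position i ~ s·j: on the left the
    -- coefficient of twist (adjoint (Source a)), in the form given by
    -- coeff-twisted-adjoint, with i′ + s·j ~ s·k; on the right Target (transformed a).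
    Matches : (ℕ → Carrier) → ℕ → ℕ → ℕ → Set ℓ
    Matches a i i′ j = η⁻¹ * frob (s ℕ.* j) (coeff (Source a) i′) ≈ coeff (Target (transformed a)) i

    -- j = 0: the top coefficient η a_0^{q^h} of Source a is brought to position 0
    matches-zero : ∀ a {i i′} → i ~ s ℕ.* 0 → i′ ℕ.+ s ℕ.* 0 ~ s ℕ.* k → Matches a i i′ 0
    matches-zero a {i} {i′} i~0 e = begin
      η⁻¹ * frob (s ℕ.* 0) (coeff (Source a) i′)  ≈⟨ *-congˡ (frob-cong (s ℕ.* 0) (coeff-Hpoly-top η (+ h) a i′~sk)) ⟩
      η⁻¹ * frob (s ℕ.* 0) (η * frobℤ (+ h) (a 0)) ≡⟨ ≡.cong (λ m → η⁻¹ * frob m (η * frobℤ (+ h) (a 0))) (ℕₚ.*-zeroʳ s) ⟩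
      η⁻¹ * frob 0 (η * frobℤ (+ h) (a 0))         ≈⟨ *-congˡ (frob-0 _) ⟩
      η⁻¹ * (η * frobℤ (+ h) (a 0))                ≈⟨ cancel-left η⁻¹η≈1 ⟩
      frobℤ (+ h) (a 0)                            ≈⟨ frobℤ-pos h (a 0) ⟩
      transformed a 0                              ≈˘⟨ coeff-Hpoly-below η⁻¹ h′ (transformed a) k≥1 i~0 ⟩
      coeff (Target (transformed a)) i             ∎
      where
      i′~sk = scaled-difference s k e (≡.cong (_% n) (ℕₚ.+-identityʳ k))

    -- 0 < j < k: a_{k-j} is brought to position s·j
    matches-middle : ∀ a {i i′} j → suc j < k → i ~ s ℕ.* suc j → i′ ℕ.+ s ℕ.* suc j ~ s ℕ.* k → Matches a i i′ (suc j)
    matches-middle a {i} {i′} j j<k i~sj e = begin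
      η⁻¹ * frob (s ℕ.* suc j) (coeff (Source a) i′)   ≈⟨ *-congˡ (frob-cong (s ℕ.* suc j) (coeff-Hpoly-below η (+ h) a k∸j<k i′~s[k∸j])) ⟩
      transformed a (suc j)                            ≈˘⟨ coeff-Hpoly-below η⁻¹ h′ (transformed a) j<k i~sj ⟩
      coeff (Target (transformed a)) i                 ∎
      where
      k∸j<k = ℕₚ.∸-monoʳ-< {k} {suc j} {0} ℕ.z<s (ℕₚ.<⇒≤ j<k)
      i′~s[k∸j] = scaled-difference s (k ∸ suc j) e (≡.cong (_% n) (ℕₚ.m∸n+n≡m (ℕₚ.<⇒≤ j<k)))

    -- j = k: the coefficient a_0 is brought to position s·k
    matches-top : ∀ a {i i′} → i ~ s ℕ.* k → i′ ℕ.+ s ℕ.* k ~ s ℕ.* k → Matches a i i′ k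
    matches-top a {i} {i′} i~sk e = begin
      η⁻¹ * frob (s ℕ.* k) (coeff (Source a) i′)  ≈⟨ *-congˡ (frob-cong (s ℕ.* k) (coeff-Hpoly-below η (+ h) a k≥1 i′~s0)) ⟩
      η⁻¹ * frob (s ℕ.* k) (a 0)                  ≈˘⟨ *-congˡ (frobℤ-difference (s ℕ.* k) h (a 0)) ⟩
      η⁻¹ * frobℤ h′ (transformed a 0)            ≈˘⟨ coeff-Hpoly-top η⁻¹ h′ (transformed a) i~sk ⟩
      coeff (Target (transformed a)) i            ∎
      where
      i′~s0 = scaled-difference s 0 e ≡.refl

    -- k < j < n: both coefficients vanish, position s·(k + n - j) of Source a
    -- lying strictly between s·k and s·n
    matches-above : ∀ a {i i′ j} → k < j → j < n → i ~ s ℕ.* j → i′ ℕ.+ s ℕ.* j ~ s ℕ.* k → Matches a i i′ j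
    matches-above a {i} {i′} {j} k<j j<n i~sj e = begin
      η⁻¹ * frob (s ℕ.* j) (coeff (Source a) i′)  ≈⟨ *-congˡ (frob-cong (s ℕ.* j) (coeff-Hpoly-above η (+ h) a k<d d<n i′~sd)) ⟩
      η⁻¹ * frob (s ℕ.* j) 0#                     ≈⟨ *-congˡ (frob-0# (s ℕ.* j)) ⟩
      η⁻¹ * 0#                                    ≈⟨ zeroʳ η⁻¹ ⟩
      0#                                          ≈˘⟨ coeff-Hpoly-above η⁻¹ h′ (transformed a) k<j j<n i~sj ⟩
      coeff (Target (transformed a)) i            ∎
      where
      d = k ℕ.+ n ∸ j
      d<n : d < n
      d<n = ℕₚ.m<n+o⇒m∸n<o (k ℕ.+ n) j (ℕₚ.+-monoˡ-< n k<j)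
      k<d : k < d
      k<d = ℕₚ.m+n≤o⇒m≤o∸n (suc k) (ℕₚ.+-monoʳ-< k j<n)
      i′~sd = scaled-difference s d e (≡.trans (≡.cong (_% n) (ℕₚ.m∸n+n≡m (ℕₚ.≤-trans (ℕₚ.<⇒≤ j<n) (ℕₚ.m≤n+m n k))))
                                               ([m+n]%n≡m%n k n))

    matches : ∀ a {i i′ j} → j < n → i ~ s ℕ.* j → i′ ℕ.+ s ℕ.* j ~ s ℕ.* k → Matches a i i′ j
    matches a {j = j} j<n i~sj e with ℕₚ.<-cmp j k
    matches a {j = zero} j<n i~sj e   | tri< _ _ _ = matches-zero a i~sj e
    matches a {j = suc j} j<n i~sj e  | tri< j<k _ _ = matches-middle a j j<k i~sj e
    ... | tri≈ _ ≡.refl _ = matches-top a i~sj e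
    ... | tri> _ _ k<j = matches-above a k<j j<n i~sj e

    twist-adjoint : ∀ a f g → f ≋ adjoint g → g ≋ Source a → twist f ≋ Target (transformed a)
    twist-adjoint a f g f≋ĝ g≋Source = coeff⇒≋ λ i → begin
      coeff (twist f) i                                        ≈⟨ coeff-twisted-adjoint (s ℕ.* k) η⁻¹ f g f≋ĝ (⊖-+ (s ℕ.* k) i) ⟩
      η⁻¹ * frob i (coeff g (s ℕ.* k ⊖ i))                     ≈⟨ *-congˡ (frob-~ _ (s*log i)) ⟩
      η⁻¹ * frob (s ℕ.* log i) (coeff g (s ℕ.* k ⊖ i))          ≈⟨ *-congˡ (frob-cong (s ℕ.* log i) (g≋Source _)) ⟩
      η⁻¹ * frob (s ℕ.* log i) (coeff (Source a) (s ℕ.* k ⊖ i)) ≈⟨ matches a (log<n i) (s*log i) (position-sum i) ⟩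
      coeff (Target (transformed a)) i                         ∎
      where
      position-sum : ∀ i → s ℕ.* k ⊖ i ℕ.+ s ℕ.* log i ~ s ℕ.* k
      position-sum i = ≡.trans (~-+ (≡.refl {x = (s ℕ.* k ⊖ i) % n}) (≡.sym (s*log i))) (⊖-+ (s ℕ.* k) i)

    adjoint-code-equivalent : Equivalent (adjointCode (H k s η (+ h))) (H k s η⁻¹ h′)
    adjoint-code-equivalent =
      L₁ , L₂ , (λ x → x) ,
      mono-permutation (s ℕ.* k) ηη⁻¹≈1 , mono-permutation 0 (*-identityˡ 1#) , identity-automorphism ,
      reached , preserved
      where
      preserved : ∀ f → adjointCode (H k s η (+ h)) f → H k s η⁻¹ h′ (twist f)
      preserved f (g , (a , g≋Source) , f≋ĝ) = transformed a , twist-adjoint a f g f≋ĝ g≋Source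
      reached : ∀ g′ → H k s η⁻¹ h′ g′ → ∃[ f ] (adjointCode (H k s η (+ h)) f × g′ ≋ twist f)
      reached g′ (b , g′≋Target) =
        adjoint (Source a) , (Source a , (a , λ _ → refl) , λ _ → refl) ,
        λ x → trans (g′≋Target x)
                (trans (Hpoly-cong k≥1 η⁻¹ h′ (λ j j<k → sym (transformed-untransformed b j j<k)) x)
                       (sym (twist-adjoint a (adjoint (Source a)) (Source a) (λ _ → refl) (λ _ → refl) x)))
        where a = untransformed b

open import Data.Product using (_,_; proj₁; proj₂)
open import Data.Nat.Primality using (prime⇒nonZero)
open import Data.Nat.Properties using (m^n≢0)
open import Relation.Binary.PropositionalEquality using (refl)

prime-power-nonzero : ∀ {q} → IsPrimePower q → NonZero q
prime-power-nonzero (p , e , p-prime , _ , refl) = m^n≢0 p e {{prime⇒nonZero p-prime}}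

proposition4p3 : ∀ {c ℓ : Level} (q : ℕ) → IsPrimePower q →
    (n : ℕ) → .{{_ : NonZero n}} → (k s h : ℕ) →
    1 ≤ k → 1 ≤ s → 1 ≤ h → gcd n s ≡ 1 → k < n →
    (F : CommutativeRing c ℓ) →
    FiniteFieldTheory.IsField F →
    FiniteFieldTheory.HasCardinality F (q ℕ.^ n) →
    let open CommutativeRing F
        open FiniteFieldTheory F
        open QPoly q n
    in (η η⁻¹ : Carrier) → ¬ (η ≈ 0#) → η * η⁻¹ ≈ 1# →
    ¬ (norm s η ≈ pow (- 1#) (n ℕ.* k)) →
    Equivalent (adjointCode (H k s η (+ h))) (H k s η⁻¹ (+ (s ℕ.* k) ℤ.- + h))
proposition4p3 q q-prime-power n k s h k≥1 _ _ gcd≡1 k<n F isField card η η⁻¹ _ ηη⁻¹≈1 _ =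
  AdjointEquivalence.adjoint-code-equivalent F isField q n {{prime-power-nonzero q-prime-power}} card
    k s t st~1 k≥1 k<n h η η⁻¹ ηη⁻¹≈1
  where
  unit = Congruence.modular-inverse n s gcd≡1
  t = proj₁ unit
  st~1 = proj₂ unit
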